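{- Let $n\ge1$, let $L_n$ be the lattice of arithmetic progressions in $[n]$ with Möbius function $\mu_n$. For every $x\in L_n$ with $x\ne[n]$, $$\mu_n(x,[n])=\begin{cases}(-1)^k, & \text{if } x \text{ is the meet of } k \text{ coatoms of } L_n;\\ 0, & \text{if } x \text{ is not a meet of coatoms of } L_n.\end{cases}$$
   Context: $L_n$ is the set of all subsets of $[n]=\{1,\ldots,n\}$ that are arithmetic progressions $\{a,a+r,\ldots,a+(k-1)r\}$ ($a$, $r\ge1$, $k\ge0$ integers; including $\emptyset$, singletons and $2$-element subsets), ordered by inclusion; it is a lattice with minimum $\emptyset$, maximum $[n]$, and meet equal to intersection. Coatoms are elements covered by $[n]$; "the meet of $k$ coatoms" means the meet of a set of $k$ distinct coatoms (such a set is unique when it exists). The Möbius function is defined by $\mu_n(x,x)=1$ and $\mu_n(x,y)=-\sum_{x\le z<y}\mu_n(x,z)$ for $x<y$. -}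

module Defs where

open import Data.Bool using (Bool; true; false; _∧_; if_then_else_)
open import Data.Nat using (ℕ; zero; suc; _+_; _*_; _∸_; _≤ᵇ_) renaming (_≡ᵇ_ to _==_)
open import Data.Fin using (Fin; toℕ)
open import Data.Fin.Subset using (Subset; ⊤; _⊆_)
open import Data.Fin.Subset.Properties using (_⊆?_)
open import Data.Integer using (ℤ; -_) renaming (_+_ to _+ℤ_)
open import Data.List using (List; []; _∷_; map; foldr; filter; concatMap; upTo; deduplicate; filterᵇ)
open import Data.Bool.ListAction using (any)
open import Data.List.Membership.Propositional using (_∈_)
open import Data.Vec using (tabulate)
open import Data.Vec.Properties using (≡-dec)
import Data.Bool.Properties as BoolP
open import Data.Product using (_×_; _,_)
open import Data.Sum using (_⊎_)
open import Relation.Nullary using (¬_; yes; no; ¬?)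
open import Relation.Nullary.Decidable using (_×-dec_)
open import Relation.Binary.PropositionalEquality using (_≡_; _≢_)
open import Relation.Binary.Definitions using (DecidableEquality)

-- Elements of [n] = {1,…,n} are represented by Fin n, the element j : Fin n
-- standing for the integer (toℕ j + 1).  Subsets of [n] are 'Subset n'.

_≟S_ : ∀ {n} → DecidableEquality (Subset n)
_≟S_ = ≡-dec BoolP._≟_

-- The arithmetic progression {a, a+r, …, a+(k-1)r} as a subset of [n]
-- (terms exceeding n are simply not represented; see 'validAP').
apSubset : (n a r k : ℕ) → Subset n
apSubset n a r k = tabulate (λ j → any (λ i → suc (toℕ j) == a + i * r) (upTo k))

validAP : (n a r k : ℕ) → Bool
validAP n a r zero    = true
validAP n a r (suc k) = (1 ≤ᵇ a) ∧ (1 ≤ᵇ r) ∧ (a + k * r ≤ᵇ n)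

-- All parameter triples with 1 ≤ a ≤ n, 1 ≤ r ≤ n, 0 ≤ k ≤ n
-- (for n ≥ 1 this loses no progression: a nonempty AP in [n] has a ≤ n,
--  at most n terms, and if it has ≥ 2 terms then r ≤ n - 1).
triples : ℕ → List (ℕ × ℕ × ℕ)
triples n =
  concatMap (λ a → concatMap (λ r → map (λ k → (suc a , suc r , k)) (upTo (suc n))) (upTo n)) (upTo n)

Ln : (n : ℕ) → List (Subset n)
Ln n = deduplicate _≟S_
  (map (λ { (a , r , k) → apSubset n a r k })
       (filterᵇ (λ { (a , r , k) → validAP n a r k }) (triples n)))

sumℤ : List ℤ → ℤ
sumℤ = foldr _+ℤ_ (ℤ.pos 0)

μ' : ∀ {n} → ℕ → List (Subset n) → Subset n → Subset n → ℤ
μ' zero    P x y = ℤ.pos 0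
μ' (suc m) P x y with x ≟S y
... | yes _ = ℤ.pos 1
... | no  _ with x ⊆? y
...   | no  _ = ℤ.pos 0
...   | yes _ = - sumℤ (map (μ' m P x)
                   (filter (λ z → (x ⊆? z) ×-dec ((z ⊆? y) ×-dec ¬? (z ≟S y))) P))

-- The Möbius function μ_n of L_n.  The fuel suc n suffices: every recursive
-- call strictly shrinks y inside [n], so the recursion depth is ≤ n + 1.
μ : (n : ℕ) → Subset n → Subset n → ℤ
μ n x y = μ' (suc n) (Ln n) x y

IsCoatom : (n : ℕ) → Subset n → Set
IsCoatom n c = c ∈ Ln n × c ≢ ⊤ × (∀ z → z ∈ Ln n → c ⊆ z → z ≡ c ⊎ z ≡ ⊤)

module Submission where

-- By the crosscut theorem for the coatoms, μ(x,[n]) = Σ (-1)^|T| over the sets T of coatoms with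
-- ⋂ T = x, provided [n] and all meets of coatoms lie in Lₙ. It holds by inclusion–exclusion:
-- for z ⊇ x in Lₙ, the alternating sum over sets T of coatoms above x with z ⊆ ⋂ T is 1 if z = [n]
-- and 0 otherwise, and pairing this with μ(x,z) leaves only the sets T with ⋂ T = x.
-- The coatoms of Lₙ are [1,n-1], [2,n] and {1, 1+p, …, n} for the primes p dividing n-1, and every
-- meet of coatoms is a progression of multiples of some m ∣ n-1, shifted by 1 and possibly missing
-- its first or last term. Each coatom c has a point outside c lying in all other coatoms (n, 1, and
-- 1 plus the p-free part of n-1, respectively), so distinct sets of coatoms have distinct meets and
-- at most one set T contributes: the set of all coatoms above x, when x is their meet.

open import Defs
open import Data.Nat using (ℕ; zero; suc; _≤_; _<_; z≤n; s≤s)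
open import Data.Integer using (ℤ; _^_; -1ℤ; 0ℤ)
open import Data.Fin.Subset using (Subset; ⊤; ⋂; _⊆_; _∩_) renaming (_∈_ to _∈ₛ_; _∉_ to _∉ₛ_)
open import Data.Fin.Subset.Properties using (⊆-antisym; ⊆⊤; ∈⊤; x∈p∩q⁺)
open import Data.List using (List; []; _∷_; length)
open import Data.List.Membership.Propositional using (_∈_; _∉_; find; lose)
open import Data.List.Relation.Unary.All as All using (All; []; _∷_)
open import Data.List.Relation.Unary.Unique.Propositional using (Unique)
open import Data.Product using (_×_; _,_; proj₁; proj₂; ∃-syntax)
open import Data.Sum using (_⊎_; inj₁; inj₂)
open import Data.Empty using (⊥-elim)
open import Function using (_∘′_)
open import Function.Bundles using (_⇔_; mk⇔; Equivalence)
open import Relation.Nullary using (Dec; yes; no; ¬_; contradiction)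
open import Relation.Binary.PropositionalEquality
  using (_≡_; _≢_; refl; sym; trans; cong; subst; module ≡-Reasoning)

module Crosscut where

  import Data.Nat as ℕ
  open import Data.Nat.Properties using (<-≤-trans; m≤n⇒m≤1+n; <-irrefl; ≤⇒≯; m≤n+m; +-monoˡ-≤; +-suc; +-identityʳ)
  open import Data.Integer using (_+_; _*_; -_; 1ℤ)
  import Data.Integer.Properties as ℤ
  open import Data.Integer.Tactic.RingSolver using (solve-∀)
  open import Data.Fin.Subset using (∣_∣; inside; outside)
  open import Data.Fin.Subset.Properties using (_⊆?_; ⊆-refl; ⊆-trans; p∩q⊆p; p∩q⊆q; p⊆q⇒∣p∣≤∣q∣; drop-∷-⊆; ∣p∣≤n)
  open import Data.Vec using ([]; _∷_; here)
  open import Data.List using (map; filter; _++_)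
  open import Data.List.Membership.Propositional.Properties
    using (∈-filter⁻; ∈-filter⁺; ∈-++⁺ˡ; ∈-++⁺ʳ; ∈-++⁻; ∈-map⁺; ∈-map⁻)
  import Data.List.Membership.DecPropositional as DecMembership
  open import Data.List.Relation.Unary.Any using (here; there; any?)
  open import Data.List.Relation.Unary.All using (all?)
  open import Data.List.Relation.Unary.All.Properties using (All¬⇒¬Any)
  open import Data.List.Relation.Unary.Unique.Propositional using ([]; _∷_)
  open import Relation.Nullary using (¬?)
  open import Relation.Nullary.Decidable using (_×-dec_; _⊎-dec_; _→-dec_; map′)
  open import Relation.Unary using (Pred; Decidable)
  open import Relation.Binary.Definitions using (DecidableEquality)
  open import Relation.Binary.PropositionalEquality using (cong₂)

  ∑ : ∀ {a} {A : Set a} → List A → (A → ℤ) → ℤ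
  ∑ L f = sumℤ (map f L)

  infixr 8 [_]·_

  [_]·_ : ∀ {p} {P : Set p} → Dec P → ℤ → ℤ
  [ yes _ ]· v = v
  [ no _ ]· v = 0ℤ

  module _ {p} {P : Set p} where

    []·-yes : (d : Dec P) {v : ℤ} → P → [ d ]· v ≡ v
    []·-yes (yes _) _ = refl
    []·-yes (no ¬p) p = contradiction p ¬p

    []·-no : (d : Dec P) {v : ℤ} → ¬ P → [ d ]· v ≡ 0ℤ
    []·-no (yes p) ¬p = contradiction p ¬p
    []·-no (no _) _ = refl

    []·-*ˡ : (d : Dec P) (u v : ℤ) → u * [ d ]· v ≡ [ d ]· (u * v)
    []·-*ˡ (yes _) u v = refl
    []·-*ˡ (no _) u v = ℤ.*-zeroʳ u

    []·-*-[]· : ∀ {q} {Q : Set q} (d : Dec P) (e : Dec Q) (u s : ℤ) → [ d ]· u * [ e ]· s ≡ s * [ d ]· [ e ]· u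
    []·-*-[]· (yes _) (yes _) u s = ℤ.*-comm u s
    []·-*-[]· (yes _) (no _) u s = trans (ℤ.*-zeroʳ u) (sym (ℤ.*-zeroʳ s))
    []·-*-[]· (no _) _ u s = sym (ℤ.*-zeroʳ s)

  module _ {a} {A : Set a} where

    ∑-cong : (L : List A) {f g : A → ℤ} → (∀ z → z ∈ L → f z ≡ g z) → ∑ L f ≡ ∑ L g
    ∑-cong [] eq = refl
    ∑-cong (x ∷ L) eq = cong₂ _+_ (eq x (here refl)) (∑-cong L (λ z z∈ → eq z (there z∈)))

    ∑-zero : (L : List A) {f : A → ℤ} → (∀ z → z ∈ L → f z ≡ 0ℤ) → ∑ L f ≡ 0ℤ
    ∑-zero [] eq = refl
    ∑-zero (x ∷ L) eq = cong₂ _+_ (eq x (here refl)) (∑-zero L (λ z z∈ → eq z (there z∈)))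

    ∑-+ : (L : List A) (f g : A → ℤ) → ∑ L (λ z → f z + g z) ≡ ∑ L f + ∑ L g
    ∑-+ [] f g = refl
    ∑-+ (x ∷ L) f g = trans (cong (f x + g x +_) (∑-+ L f g)) (interchange (f x) (g x) (∑ L f) (∑ L g))
      where
        interchange : ∀ a b c d → (a + b) + (c + d) ≡ (a + c) + (b + d)
        interchange = solve-∀

    ∑-neg : (L : List A) (f : A → ℤ) → ∑ L (λ z → - f z) ≡ - ∑ L f
    ∑-neg [] f = refl
    ∑-neg (x ∷ L) f = trans (cong (- f x +_) (∑-neg L f)) (sym (ℤ.neg-distrib-+ (f x) (∑ L f)))

    ∑-*ˡ : (L : List A) (c : ℤ) (f : A → ℤ) → ∑ L (λ z → c * f z) ≡ c * ∑ L f
    ∑-*ˡ [] c f = sym (ℤ.*-zeroʳ c)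
    ∑-*ˡ (x ∷ L) c f = trans (cong (c * f x +_) (∑-*ˡ L c f)) (sym (ℤ.*-distribˡ-+ c (f x) (∑ L f)))

    ∑-++ : (L M : List A) (f : A → ℤ) → ∑ (L ++ M) f ≡ ∑ L f + ∑ M f
    ∑-++ [] M f = sym (ℤ.+-identityˡ (∑ M f))
    ∑-++ (x ∷ L) M f = trans (cong (f x +_) (∑-++ L M f)) (sym (ℤ.+-assoc (f x) (∑ L f) (∑ M f)))

    ∑-filter : ∀ {p} {P : Pred A p} (P? : Decidable P) (L : List A) (f : A → ℤ) →
               ∑ (filter P? L) f ≡ ∑ L (λ z → [ P? z ]· f z)
    ∑-filter P? [] f = refl
    ∑-filter P? (x ∷ L) f with P? x
    ... | yes _ = cong (f x +_) (∑-filter P? L f)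
    ... | no _ = trans (∑-filter P? L f) (sym (ℤ.+-identityˡ _))

    ∑-[≟]· : (_≟_ : DecidableEquality A) (L : List A) → Unique L → (y : A) → y ∈ L → (f : A → ℤ) →
             ∑ L (λ z → [ z ≟ y ]· f z) ≡ f y
    ∑-[≟]· _≟_ (x ∷ L) (x∉L ∷ _) x (here refl) f = begin
      [ x ≟ x ]· f x + ∑ L (λ z → [ z ≟ x ]· f z)
        ≡⟨ cong₂ _+_ ([]·-yes (x ≟ x) refl) (∑-zero L (λ z z∈ → []·-no (z ≟ x) (λ { refl → All¬⇒¬Any x∉L z∈ }))) ⟩
      f x + 0ℤ
        ≡⟨ ℤ.+-identityʳ (f x) ⟩
      f x ∎
      where open ≡-Reasoning
    ∑-[≟]· _≟_ (x ∷ L) (x∉L ∷ uL) y (there y∈) f = begin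
      [ x ≟ y ]· f x + ∑ L (λ z → [ z ≟ y ]· f z)
        ≡⟨ cong₂ _+_ ([]·-no (x ≟ y) (λ { refl → All¬⇒¬Any x∉L y∈ })) (∑-[≟]· _≟_ L uL y y∈ f) ⟩
      0ℤ + f y
        ≡⟨ ℤ.+-identityˡ (f y) ⟩
      f y ∎
      where open ≡-Reasoning

  module _ {a b} {A : Set a} {B : Set b} where

    ∑-map : (L : List A) (h : A → B) (f : B → ℤ) → ∑ (map h L) f ≡ ∑ L (λ z → f (h z))
    ∑-map [] h f = refl
    ∑-map (x ∷ L) h f = cong (f (h x) +_) (∑-map L h f)

    ∑-swap : (L : List A) (M : List B) (g : A → B → ℤ) →
             ∑ L (λ z → ∑ M (g z)) ≡ ∑ M (λ w → ∑ L (λ z → g z w))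
    ∑-swap [] M g = sym (∑-zero M (λ _ _ → refl))
    ∑-swap (x ∷ L) M g = trans (cong (∑ M (g x) +_) (∑-swap L M g)) (sym (∑-+ M (g x) (λ w → ∑ L (λ z → g z w))))

  module _ {a} {A : Set a} where

    sublists : List A → List (List A)
    sublists [] = [] ∷ []
    sublists (x ∷ L) = sublists L ++ map (x ∷_) (sublists L)

    ∑-sublists-∷ : (x : A) (L : List A) (g : List A → ℤ) →
                   ∑ (sublists (x ∷ L)) g ≡ ∑ (sublists L) g + ∑ (sublists L) (λ T → g (x ∷ T))
    ∑-sublists-∷ x L g = trans (∑-++ (sublists L) _ g) (cong (∑ (sublists L) g +_) (∑-map (sublists L) (x ∷_) g))

    ∈-sublists⇒⊆ : (L : List A) {T : List A} → T ∈ sublists L → ∀ {c} → c ∈ T → c ∈ L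
    ∈-sublists⇒⊆ [] (here refl) ()
    ∈-sublists⇒⊆ (x ∷ L) T∈ c∈ with ∈-++⁻ (sublists L) T∈
    ... | inj₁ T∈′ = there (∈-sublists⇒⊆ L T∈′ c∈)
    ... | inj₂ xT∈ with ∈-map⁻ (x ∷_) xT∈
    ...   | T′ , T′∈ , refl with c∈
    ...     | here refl = here refl
    ...     | there c∈′ = there (∈-sublists⇒⊆ L T′∈ c∈′)

    ∈-sublists⇒length≤ : (L : List A) {T : List A} → T ∈ sublists L → length T ≤ length L
    ∈-sublists⇒length≤ [] (here refl) = z≤n
    ∈-sublists⇒length≤ (x ∷ L) T∈ with ∈-++⁻ (sublists L) T∈
    ... | inj₁ T∈′ = m≤n⇒m≤1+n (∈-sublists⇒length≤ L T∈′)
    ... | inj₂ xT∈ with ∈-map⁻ (x ∷_) xT∈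
    ...   | T′ , T′∈ , refl = s≤s (∈-sublists⇒length≤ L T′∈)

    ∑-sublists-only-self : (L : List A) (g : List A → ℤ) →
                           (∀ T → T ∈ sublists L → T ≢ L → g T ≡ 0ℤ) → ∑ (sublists L) g ≡ g L
    ∑-sublists-only-self [] g vanish = ℤ.+-identityʳ (g [])
    ∑-sublists-only-self (x ∷ L) g vanish = begin
      ∑ (sublists (x ∷ L)) g                                      ≡⟨ ∑-sublists-∷ x L g ⟩
      ∑ (sublists L) g + ∑ (sublists L) (λ T → g (x ∷ T))         ≡⟨ cong₂ _+_ without-x with-x ⟩
      0ℤ + g (x ∷ L)                                              ≡⟨ ℤ.+-identityˡ _ ⟩
      g (x ∷ L) ∎
      where
        open ≡-Reasoning
        without-x : ∑ (sublists L) g ≡ 0ℤ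
        without-x = ∑-zero (sublists L) λ T T∈ →
          vanish T (∈-++⁺ˡ T∈) λ { refl → <-irrefl refl (∈-sublists⇒length≤ L T∈) }
        with-x : ∑ (sublists L) (λ T → g (x ∷ T)) ≡ g (x ∷ L)
        with-x = ∑-sublists-only-self L (λ T → g (x ∷ T)) λ T T∈ T≢L →
          vanish (x ∷ T) (∈-++⁺ʳ (sublists L) (∈-map⁺ (x ∷_) T∈)) λ { refl → T≢L refl }

    ∈-sublists-≢⇒missing : (L : List A) → Unique L → ∀ {T} → T ∈ sublists L → T ≢ L → ∃[ c ] (c ∈ L × c ∉ T)
    ∈-sublists-≢⇒missing [] _ (here refl) T≢L = ⊥-elim (T≢L refl)
    ∈-sublists-≢⇒missing (x ∷ L) (x∉L ∷ uL) T∈ T≢L with ∈-++⁻ (sublists L) T∈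
    ... | inj₁ T∈′ = x , here refl , λ x∈T → All¬⇒¬Any x∉L (∈-sublists⇒⊆ L T∈′ x∈T)
    ... | inj₂ xT∈ with ∈-map⁻ (x ∷_) xT∈
    ...   | T′ , T′∈ , refl with ∈-sublists-≢⇒missing L uL T′∈ (λ { refl → T≢L refl })
    ...     | c , c∈ , c∉ = c , there c∈ , λ { (here refl) → All¬⇒¬Any x∉L c∈ ; (there c∈T′) → c∉ c∈T′ }

  ⊆∧≢⇒∣p∣<∣q∣ : ∀ {n} {p q : Subset n} → p ⊆ q → p ≢ q → ∣ p ∣ < ∣ q ∣
  ⊆∧≢⇒∣p∣<∣q∣ {p = []} {[]} _ p≢q = contradiction refl p≢q
  ⊆∧≢⇒∣p∣<∣q∣ {p = inside ∷ p} {inside ∷ q} p⊆q p≢q = s≤s (⊆∧≢⇒∣p∣<∣q∣ (drop-∷-⊆ p⊆q) (p≢q ∘′ cong (inside ∷_)))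
  ⊆∧≢⇒∣p∣<∣q∣ {p = outside ∷ p} {outside ∷ q} p⊆q p≢q = ⊆∧≢⇒∣p∣<∣q∣ (drop-∷-⊆ p⊆q) (p≢q ∘′ cong (outside ∷_))
  ⊆∧≢⇒∣p∣<∣q∣ {p = outside ∷ p} {inside ∷ q} p⊆q _ = s≤s (p⊆q⇒∣p∣≤∣q∣ (drop-∷-⊆ p⊆q))
  ⊆∧≢⇒∣p∣<∣q∣ {p = inside ∷ p} {outside ∷ q} p⊆q _ with () ← p⊆q here

  between? : ∀ {n} (x w z : Subset n) → Dec (x ⊆ z × z ⊆ w × z ≢ w)
  between? x w z = (x ⊆? z) ×-dec ((z ⊆? w) ×-dec ¬? (z ≟S w))

  module _ {n : ℕ} (P : List (Subset n)) where

    μ'-fuel : ∀ m m′ (x z : Subset n) → ∣ z ∣ < m → ∣ z ∣ < m′ → μ' m P x z ≡ μ' m′ P x z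
    μ'-fuel (suc m) (suc m′) x z (s≤s z<m) (s≤s z<m′) with x ≟S z
    ... | yes _ = refl
    ... | no _ with x ⊆? z
    ...   | no _ = refl
    ...   | yes _ = cong -_ (∑-cong (filter (between? x z) P) λ y y∈ →
            let _ , y⊆z , y≢z = proj₂ (∈-filter⁻ (between? x z) {xs = P} y∈)
                y<z = ⊆∧≢⇒∣p∣<∣q∣ y⊆z y≢z
            in μ'-fuel m m′ x y (<-≤-trans y<z z<m) (<-≤-trans y<z z<m′))

    μ'-refl : ∀ m (x : Subset n) → μ' (suc m) P x x ≡ 1ℤ
    μ'-refl m x with x ≟S x
    ... | yes _ = refl
    ... | no x≢x = contradiction refl x≢x

    μ'-step : ∀ m (x w : Subset n) → x ≢ w → x ⊆ w →
              μ' (suc m) P x w ≡ - ∑ (filter (between? x w) P) (μ' m P x)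
    μ'-step m x w x≢w x⊆w with x ≟S w
    ... | yes x≡w = contradiction x≡w x≢w
    ... | no _ with x ⊆? w
    ...   | no x⊈w = ⊥-elim (x⊈w x⊆w)
    ...   | yes _ = refl

    module _ (uniqueP : Unique P) where

      ∑-μ-interval-refl : (x : Subset n) → x ∈ P →
        ∑ P (λ z → [ x ⊆? z ]· [ z ⊆? x ]· μ' (suc n) P x z) ≡ 1ℤ
      ∑-μ-interval-refl x x∈P = trans (∑-cong P (λ z _ → only-x z)) (∑-[≟]· _≟S_ P uniqueP x x∈P (λ _ → 1ℤ))
        where
          only-x : ∀ z → [ x ⊆? z ]· [ z ⊆? x ]· μ' (suc n) P x z ≡ [ z ≟S x ]· 1ℤ
          only-x z with z ≟S x | x ⊆? z | z ⊆? x
          ... | yes refl | yes _ | yes _ = μ'-refl n x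
          ... | yes refl | no x⊈x | _ = ⊥-elim (x⊈x ⊆-refl)
          ... | yes refl | yes _ | no x⊈x = ⊥-elim (x⊈x ⊆-refl)
          ... | no z≢x | yes x⊆z | yes z⊆x = contradiction (⊆-antisym z⊆x x⊆z) z≢x
          ... | no _ | yes _ | no _ = refl
          ... | no _ | no _ | _ = refl

      ∑-μ-interval-≢ : (x w : Subset n) → w ∈ P → x ⊆ w → x ≢ w →
        ∑ P (λ z → [ x ⊆? z ]· [ z ⊆? w ]· μ' (suc n) P x z) ≡ 0ℤ
      ∑-μ-interval-≢ x w w∈P x⊆w x≢w = begin
        ∑ P g
          ≡⟨ ∑-cong P (λ z _ → split z) ⟩
        ∑ P (λ z → [ z ≟S w ]· g z + [ between? x w z ]· μ' n P x z)
          ≡⟨ ∑-+ P _ _ ⟩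
        ∑ P (λ z → [ z ≟S w ]· g z) + ∑ P (λ z → [ between? x w z ]· μ' n P x z)
          ≡⟨ cong₂ _+_ (∑-[≟]· _≟S_ P uniqueP w w∈P g) (sym (∑-filter (between? x w) P (μ' n P x))) ⟩
        g w + S
          ≡⟨ cong (_+ S) (trans ([]·-yes (x ⊆? w) x⊆w) (trans ([]·-yes (w ⊆? w) ⊆-refl) (μ'-step n x w x≢w x⊆w))) ⟩
        - S + S
          ≡⟨ ℤ.+-inverseˡ S ⟩
        0ℤ ∎
        where
          open ≡-Reasoning
          g : Subset n → ℤ
          g z = [ x ⊆? z ]· [ z ⊆? w ]· μ' (suc n) P x z
          S : ℤ
          S = ∑ (filter (between? x w) P) (μ' n P x)
          -- μ' (suc n) and μ' n agree strictly below w, since ∣ w ∣ ≤ n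
          split : ∀ z → [ x ⊆? z ]· [ z ⊆? w ]· μ' (suc n) P x z
                      ≡ [ z ≟S w ]· g z + [ between? x w z ]· μ' n P x z
          split z with z ≟S w | between? x w z
          ... | yes refl | yes (_ , _ , z≢z) = contradiction refl z≢z
          ... | yes refl | no _ = sym (ℤ.+-identityʳ _)
          ... | no z≢w | yes (x⊆z , z⊆w , _) = begin
            [ x ⊆? z ]· [ z ⊆? w ]· μ' (suc n) P x z
              ≡⟨ trans ([]·-yes (x ⊆? z) x⊆z) ([]·-yes (z ⊆? w) z⊆w) ⟩
            μ' (suc n) P x z
              ≡⟨ μ'-fuel (suc n) n x z (s≤s (∣p∣≤n z)) (<-≤-trans (⊆∧≢⇒∣p∣<∣q∣ z⊆w z≢w) (∣p∣≤n w)) ⟩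
            μ' n P x z
              ≡⟨ ℤ.+-identityˡ _ ⟨
            0ℤ + μ' n P x z ∎
          ... | no z≢w | no ¬between with x ⊆? z | z ⊆? w
          ...   | yes x⊆z | yes z⊆w = ⊥-elim (¬between (x⊆z , z⊆w , z≢w))
          ...   | yes _ | no _ = refl
          ...   | no _ | _ = refl

      ∑-μ-interval : (x w : Subset n) → w ∈ P → x ⊆ w →
        ∑ P (λ z → [ x ⊆? z ]· [ z ⊆? w ]· μ' (suc n) P x z) ≡ [ x ≟S w ]· 1ℤ
      ∑-μ-interval x w w∈P x⊆w with x ≟S w
      ... | yes refl = ∑-μ-interval-refl x w∈P
      ... | no x≢w = ∑-μ-interval-≢ x w w∈P x⊆w x≢w

  ∈⋂⁺ : ∀ {n} {y} (T : List (Subset n)) → All (y ∈ₛ_) T → y ∈ₛ ⋂ T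
  ∈⋂⁺ [] [] = ∈⊤
  ∈⋂⁺ (c ∷ T) (y∈c ∷ y∈T) = x∈p∩q⁺ (y∈c , ∈⋂⁺ T y∈T)

  ⊆⋂⁺ : ∀ {n} {z : Subset n} (T : List (Subset n)) → (∀ {c} → c ∈ T → z ⊆ c) → z ⊆ ⋂ T
  ⊆⋂⁺ T z⊆T y∈z = ∈⋂⁺ T (All.tabulate (λ c∈T → z⊆T c∈T y∈z))

  sgn : ∀ {a} {A : Set a} → List A → ℤ
  sgn T = -1ℤ ^ length T

  coverSign : ∀ {n} → Subset n → List (Subset n) → ℤ
  coverSign z T = [ z ⊆? ⋂ T ]· sgn T

  module _ {n : ℕ} (z : Subset n) where

    ∑-coverSign-∷-⊆ : (C : List (Subset n)) (a : Subset n) → z ⊆ a → ∑ (sublists (a ∷ C)) (coverSign z) ≡ 0ℤ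
    ∑-coverSign-∷-⊆ C a z⊆a = begin
      ∑ (sublists (a ∷ C)) (coverSign z)                                    ≡⟨ ∑-sublists-∷ a C (coverSign z) ⟩
      ∑ (sublists C) (coverSign z) + ∑ (sublists C) (coverSign z ∘′ (a ∷_))  ≡⟨ cong (∑ (sublists C) (coverSign z) +_) flipped ⟩
      ∑ (sublists C) (coverSign z) + - ∑ (sublists C) (coverSign z)         ≡⟨ ℤ.+-inverseʳ (∑ (sublists C) (coverSign z)) ⟩
      0ℤ ∎
      where
        open ≡-Reasoning
        flip-sign : ∀ T → coverSign z (a ∷ T) ≡ - coverSign z T
        flip-sign T with z ⊆? a ∩ ⋂ T | z ⊆? ⋂ T
        ... | yes _ | yes _ = ℤ.-1*i≡-i (sgn T)
        ... | yes z⊆a∩T | no z⊈T = ⊥-elim (z⊈T (p∩q⊆q a (⋂ T) ∘′ z⊆a∩T))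
        ... | no z⊈a∩T | yes z⊆T = ⊥-elim (z⊈a∩T (λ y∈z → x∈p∩q⁺ (z⊆a y∈z , z⊆T y∈z)))
        ... | no _ | no _ = refl
        flipped : ∑ (sublists C) (coverSign z ∘′ (a ∷_)) ≡ - ∑ (sublists C) (coverSign z)
        flipped = trans (∑-cong (sublists C) (λ T _ → flip-sign T)) (∑-neg (sublists C) (coverSign z))

    ∑-coverSign-∷-⊈ : (C : List (Subset n)) (a : Subset n) → ¬ z ⊆ a →
                      ∑ (sublists (a ∷ C)) (coverSign z) ≡ ∑ (sublists C) (coverSign z)
    ∑-coverSign-∷-⊈ C a z⊈a = begin
      ∑ (sublists (a ∷ C)) (coverSign z)                                    ≡⟨ ∑-sublists-∷ a C (coverSign z) ⟩
      ∑ (sublists C) (coverSign z) + ∑ (sublists C) (coverSign z ∘′ (a ∷_))  ≡⟨ cong (∑ (sublists C) (coverSign z) +_) (∑-zero (sublists C) (λ T _ → vanish T)) ⟩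
      ∑ (sublists C) (coverSign z) + 0ℤ                                     ≡⟨ ℤ.+-identityʳ _ ⟩
      ∑ (sublists C) (coverSign z) ∎
      where
        open ≡-Reasoning
        vanish : ∀ T → coverSign z (a ∷ T) ≡ 0ℤ
        vanish T = []·-no (z ⊆? a ∩ ⋂ T) (λ z⊆a∩T → z⊈a (p∩q⊆p a (⋂ T) ∘′ z⊆a∩T))

    ∑-coverSign-uncovered : (C : List (Subset n)) → (∀ c → c ∈ C → ¬ z ⊆ c) → ∑ (sublists C) (coverSign z) ≡ 1ℤ
    ∑-coverSign-uncovered [] _ = trans (ℤ.+-identityʳ _) ([]·-yes (z ⊆? ⊤) ⊆⊤)
    ∑-coverSign-uncovered (a ∷ C) uncovered =
      trans (∑-coverSign-∷-⊈ C a (uncovered a (here refl))) (∑-coverSign-uncovered C (λ c c∈ → uncovered c (there c∈)))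

    ∑-coverSign-covered : (C : List (Subset n)) {c : Subset n} → c ∈ C → z ⊆ c → ∑ (sublists C) (coverSign z) ≡ 0ℤ
    ∑-coverSign-covered (a ∷ C) (here refl) z⊆a = ∑-coverSign-∷-⊆ C a z⊆a
    ∑-coverSign-covered (a ∷ C) (there c∈C) z⊆c with z ⊆? a
    ... | yes z⊆a = ∑-coverSign-∷-⊆ C a z⊆a
    ... | no z⊈a = trans (∑-coverSign-∷-⊈ C a z⊈a) (∑-coverSign-covered C c∈C z⊆c)

  module _ {n : ℕ} (P : List (Subset n)) where

    IsCoatomIn : Subset n → Set
    IsCoatomIn c = c ∈ P × c ≢ ⊤ × (∀ z → z ∈ P → c ⊆ z → z ≡ c ⊎ z ≡ ⊤)

    isCoatomIn? : Decidable IsCoatomIn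
    isCoatomIn? c = DecMembership._∈?_ _≟S_ c P ×-dec (¬? (c ≟S ⊤) ×-dec
      map′ (λ covers z z∈P → All.lookup covers z∈P) (λ covers → All.tabulate (covers _))
           (all? (λ z → (c ⊆? z) →-dec ((z ≟S c) ⊎-dec (z ≟S ⊤))) P))

    coatom-above : ∀ z → z ∈ P → z ≢ ⊤ → ∃[ c ] (IsCoatomIn c × z ⊆ c)
    coatom-above z = climb (suc n) z (m≤n+m (suc n) ∣ z ∣)
      where
        -- k bounds the number of strict ascents still possible from z
        climb : ∀ k z → n < ∣ z ∣ ℕ.+ k → z ∈ P → z ≢ ⊤ → ∃[ c ] (IsCoatomIn c × z ⊆ c)
        climb zero z n<z _ _ = ⊥-elim (≤⇒≯ (∣p∣≤n z) (subst (n <_) (+-identityʳ _) n<z))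
        climb (suc k) z n<z+1+k z∈P z≢⊤
          with any? (λ w → (z ⊆? w) ×-dec (¬? (w ≟S z) ×-dec ¬? (w ≟S ⊤))) P
        ... | yes above with find above
        ...   | w , w∈P , z⊆w , w≢z , w≢⊤ =
                let c , c-coatom , w⊆c = climb k w n<w+k w∈P w≢⊤ in c , c-coatom , ⊆-trans z⊆w w⊆c
          where
            n<w+k : n < ∣ w ∣ ℕ.+ k
            n<w+k = <-≤-trans n<z+1+k (subst (_≤ ∣ w ∣ ℕ.+ k) (sym (+-suc ∣ z ∣ k))
                      (+-monoˡ-≤ k (⊆∧≢⇒∣p∣<∣q∣ z⊆w (w≢z ∘′ sym))))
        climb (suc k) z _ z∈P z≢⊤ | no nothing-above = z , (z∈P , z≢⊤ , covers) , ⊆-refl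
          where
            covers : ∀ w → w ∈ P → z ⊆ w → w ≡ z ⊎ w ≡ ⊤
            covers w w∈P z⊆w with w ≟S z | w ≟S ⊤
            ... | yes w≡z | _ = inj₁ w≡z
            ... | no _ | yes w≡⊤ = inj₂ w≡⊤
            ... | no w≢z | no w≢⊤ = ⊥-elim (nothing-above (lose w∈P (z⊆w , w≢z , w≢⊤)))

    coatomsAbove : Subset n → List (Subset n)
    coatomsAbove x = filter (λ c → isCoatomIn? c ×-dec (x ⊆? c)) P

    ∈-coatomsAbove⇔ : ∀ x c → c ∈ coatomsAbove x ⇔ (IsCoatomIn c × x ⊆ c)
    ∈-coatomsAbove⇔ x c = mk⇔ (proj₂ ∘′ ∈-filter⁻ (λ c → isCoatomIn? c ×-dec (x ⊆? c)) {xs = P})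
                              (λ above@(c-coatom , _) → ∈-filter⁺ (λ c → isCoatomIn? c ×-dec (x ⊆? c)) (proj₁ c-coatom) above)

    module _ (uniqueP : Unique P) (⊤∈P : ⊤ ∈ P) (meet-closed : ∀ T → All IsCoatomIn T → ⋂ T ∈ P) where

      crosscut : (x : Subset n) (C : List (Subset n)) → (∀ c → c ∈ C ⇔ (IsCoatomIn c × x ⊆ c)) →
                 μ' (suc n) P x ⊤ ≡ ∑ (sublists C) (λ T → [ x ≟S ⋂ T ]· sgn T)
      crosscut x C C-spec = begin
        μ' (suc n) P x ⊤                                         ≡⟨ []·-yes (x ⊆? ⊤) ⊆⊤ ⟨
        f ⊤                                                      ≡⟨ ∑-[≟]· _≟S_ P uniqueP ⊤ ⊤∈P f ⟨
        ∑ P (λ z → [ z ≟S ⊤ ]· f z)                              ≡⟨ ∑-cong P detect-⊤ ⟩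
        ∑ P (λ z → f z * ∑ (sublists C) (coverSign z))           ≡⟨ ∑-cong P (λ z _ → sym (∑-*ˡ (sublists C) (f z) (coverSign z))) ⟩
        ∑ P (λ z → ∑ (sublists C) (λ T → f z * coverSign z T))   ≡⟨ ∑-swap P (sublists C) (λ z T → f z * coverSign z T) ⟩
        ∑ (sublists C) (λ T → ∑ P (λ z → f z * coverSign z T))   ≡⟨ ∑-cong (sublists C) term ⟩
        ∑ (sublists C) (λ T → [ x ≟S ⋂ T ]· sgn T) ∎
        where
          open ≡-Reasoning
          f : Subset n → ℤ
          f z = [ x ⊆? z ]· μ' (suc n) P x z

          detect-⊤ : ∀ z → z ∈ P → [ z ≟S ⊤ ]· f z ≡ f z * ∑ (sublists C) (coverSign z)
          detect-⊤ z z∈P with z ≟S ⊤ | x ⊆? z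
          ... | yes refl | no _ = refl
          ... | no _ | no _ = refl
          ... | yes refl | yes _ = sym (trans (cong (μ' (suc n) P x ⊤ *_) (∑-coverSign-uncovered ⊤ C ⊤-uncovered))
                                              (ℤ.*-identityʳ (μ' (suc n) P x ⊤)))
            where
              ⊤-uncovered : ∀ c → c ∈ C → ¬ ⊤ ⊆ c
              ⊤-uncovered c c∈C ⊤⊆c = proj₁ (proj₂ (proj₁ (Equivalence.to (C-spec c) c∈C))) (⊆-antisym ⊆⊤ ⊤⊆c)
          ... | no z≢⊤ | yes x⊆z =
            let c , c-coatom , z⊆c = coatom-above z z∈P z≢⊤
                c∈C = Equivalence.from (C-spec c) (c-coatom , ⊆-trans x⊆z z⊆c)
            in sym (trans (cong (μ' (suc n) P x z *_) (∑-coverSign-covered z C c∈C z⊆c)) (ℤ.*-zeroʳ (μ' (suc n) P x z)))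

          term : ∀ T → T ∈ sublists C → ∑ P (λ z → f z * coverSign z T) ≡ [ x ≟S ⋂ T ]· sgn T
          term T T∈ = begin
            ∑ P (λ z → f z * coverSign z T)
              ≡⟨ ∑-cong P (λ z _ → []·-*-[]· (x ⊆? z) (z ⊆? ⋂ T) _ (sgn T)) ⟩
            ∑ P (λ z → sgn T * [ x ⊆? z ]· [ z ⊆? ⋂ T ]· μ' (suc n) P x z)
              ≡⟨ ∑-*ˡ P (sgn T) _ ⟩
            sgn T * ∑ P (λ z → [ x ⊆? z ]· [ z ⊆? ⋂ T ]· μ' (suc n) P x z)
              ≡⟨ cong (sgn T *_) (∑-μ-interval P uniqueP x (⋂ T) (meet-closed T T-coatoms) (⊆⋂⁺ T x⊆T)) ⟩
            sgn T * [ x ≟S ⋂ T ]· 1ℤ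
              ≡⟨ []·-*ˡ (x ≟S ⋂ T) (sgn T) 1ℤ ⟩
            [ x ≟S ⋂ T ]· (sgn T * 1ℤ)
              ≡⟨ cong ([ x ≟S ⋂ T ]·_) (ℤ.*-identityʳ (sgn T)) ⟩
            [ x ≟S ⋂ T ]· sgn T ∎
            where
              T⊆C : ∀ {c} → c ∈ T → IsCoatomIn c × x ⊆ c
              T⊆C c∈T = Equivalence.to (C-spec _) (∈-sublists⇒⊆ C T∈ c∈T)
              T-coatoms : All IsCoatomIn T
              T-coatoms = All.tabulate (proj₁ ∘′ T⊆C)
              x⊆T : ∀ {c} → c ∈ T → x ⊆ c
              x⊆T c∈T = proj₂ (T⊆C c∈T)

module ArithmeticProgressions where

  open import Data.Bool using (Bool; true; false; T)
  open import Data.Bool.Properties using (T-≡)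
  open import Data.Bool.ListAction using (any)
  open import Data.Nat using (_+_; _*_; _∸_; >-nonZero; nonTrivial⇒n>1) renaming (_≡ᵇ_ to _==_)
  open import Data.Nat.Properties
    using (_≟_; _≤?_; ≤-refl; ≤-reflexive; ≤-trans; ≤-pred; <-irrefl; <⇒≤; <⇒≱; ≤∧≢⇒<; n≤1+n; n≢0⇒n>0; n≤0⇒n≡0;
           m≤m+n; m≤n+m; m≤m*n; m<m*n; m+n≡0⇒m≡0; m+[n∸m]≡n; m≤n⇒∃[o]m+o≡n; +-monoʳ-≤; +-cancelˡ-≤;
           *-comm; *-identityʳ; *-distribʳ-+; *-monoˡ-≤; *-cancelʳ-≤; *-cancelʳ-<; ≡ᵇ⇒≡; ≡⇒≡ᵇ; ≤⇒≤ᵇ)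
  open import Data.Nat.Induction using (<-wellFounded)
  open import Induction.WellFounded using (Acc; acc)
  open import Data.Nat.Divisibility using (_∣_; divides; _∣?_; ∣⇒≤; ∣-trans; ∣-refl; 0∣⇒≡0; ∣1⇒≡1)
  open import Data.Nat.Primality
    using (Prime; Irreducible; prime⇒nonTrivial; irreducible⇒prime; prime⇒irreducible; euclidsLemma; ¬prime[1])
  open import Data.Nat.LCM using (lcm; m∣lcm[m,n]; n∣lcm[m,n]; lcm-least)
  open import Data.Fin using (Fin; toℕ; fromℕ<)
  open import Data.Fin.Properties using (toℕ-fromℕ<; toℕ<n; toℕ-injective)
  open import Data.Fin.Subset.Properties using (_∈?_; x∈p∩q⁻)
  open import Data.Vec using (lookup)
  open import Data.Vec.Properties using (lookup∘tabulate; []=⇒lookup; lookup⇒[]=)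
  open import Data.List using (upTo)
  open import Data.List.Membership.Propositional.Properties
    using (∈-upTo⁺; ∈-upTo⁻; ∈-map⁺; ∈-map⁻; ∈-filter⁺; ∈-filter⁻; ∈-concatMap⁺; ∈-deduplicate⁺; ∈-deduplicate⁻)
  import Data.List.Relation.Unary.Any as Any
  open import Data.List.Relation.Unary.Any.Properties using (any⁺; any⁻)
  import Data.List.Relation.Unary.Unique.DecPropositional.Properties as Unique
  open import Data.Unit using (tt)

  InAP : ℕ → ℕ → ℕ → ℕ → Set
  InAP a r k t = ∃[ i ] (i < k × t ≡ a + i * r)

  -- The point j : Fin n stands for toℕ j + 1, so the progression starting at suc a is read off at a.
  ∈-apSubset⇔ : ∀ {n} a r k (j : Fin n) → j ∈ₛ apSubset n (suc a) r k ⇔ InAP a r k (toℕ j)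
  ∈-apSubset⇔ {n} a r k j = mk⇔ to from
    where
      test : ℕ → Bool
      test i = suc (toℕ j) == suc a + i * r
      lookup-ap : lookup (apSubset n (suc a) r k) j ≡ any test (upTo k)
      lookup-ap = lookup∘tabulate _ j
      to : j ∈ₛ apSubset n (suc a) r k → InAP a r k (toℕ j)
      to j∈ = let i , i∈ , eq = find (any⁻ test (upTo k) (Equivalence.from T-≡ (trans (sym lookup-ap) ([]=⇒lookup j∈))))
              in i , ∈-upTo⁻ i∈ , ≡ᵇ⇒≡ _ _ eq
      from : InAP a r k (toℕ j) → j ∈ₛ apSubset n (suc a) r k
      from (i , i<k , eq) = lookup⇒[]= j _ (trans lookup-ap (Equivalence.to T-≡ (any⁺ test (lose (∈-upTo⁺ i<k) (≡⇒≡ᵇ _ _ eq)))))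

  ∉-apSubset-0 : ∀ {n} a r (j : Fin n) → j ∉ₛ apSubset n a r 0
  ∉-apSubset-0 a r j j∈ with () ← trans (sym (lookup∘tabulate _ j)) ([]=⇒lookup j∈)

  module _ {N : ℕ} where

    record Describes (Q : ℕ → Set) (c : Subset (suc N)) : Set where
      constructor describes
      field ∈⇔ : ∀ j → j ∈ₛ c ⇔ Q (toℕ j)
    open Describes public

    point : ∀ t → t ≤ N → Fin (suc N)
    point t t≤N = fromℕ< (s≤s t≤N)

    toℕ≤N : (j : Fin (suc N)) → toℕ j ≤ N
    toℕ≤N j = ≤-pred (toℕ<n j)

    module _ {Q : ℕ → Set} {c : Subset (suc N)} (c≐Q : Describes Q c) where

      describes-∈ : ∀ t (t≤N : t ≤ N) → Q t → point t t≤N ∈ₛ c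
      describes-∈ t t≤N q = Equivalence.from (∈⇔ c≐Q (point t t≤N)) (subst Q (sym (toℕ-fromℕ< (s≤s t≤N))) q)

      describes-∈⁻ : ∀ t (t≤N : t ≤ N) → point t t≤N ∈ₛ c → Q t
      describes-∈⁻ t t≤N j∈ = subst Q (toℕ-fromℕ< (s≤s t≤N)) (Equivalence.to (∈⇔ c≐Q (point t t≤N)) j∈)

      describes-∉ : ∀ t (t≤N : t ≤ N) → ¬ Q t → point t t≤N ∉ₛ c
      describes-∉ t t≤N ¬q j∈ = ¬q (describes-∈⁻ t t≤N j∈)

      describes-cong : {Q′ : ℕ → Set} → (∀ t → t ≤ N → Q t → Q′ t) → (∀ t → t ≤ N → Q′ t → Q t) → Describes Q′ c
      describes-cong to from = describes λ j →
        mk⇔ (to _ (toℕ≤N j) ∘′ Equivalence.to (∈⇔ c≐Q j)) (Equivalence.from (∈⇔ c≐Q j) ∘′ from _ (toℕ≤N j))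

      describes-⊤ : (∀ t → t ≤ N → Q t) → c ≡ ⊤
      describes-⊤ always = ⊆-antisym ⊆⊤ (λ {j} _ → Equivalence.from (∈⇔ c≐Q j) (always _ (toℕ≤N j)))

    describes-⊆ : ∀ {c d Q Q′} → Describes Q c → Describes Q′ d → (∀ t → t ≤ N → Q t → Q′ t) → c ⊆ d
    describes-⊆ c≐Q d≐Q′ Q⇒Q′ {j} j∈c =
      Equivalence.from (∈⇔ d≐Q′ j) (Q⇒Q′ _ (toℕ≤N j) (Equivalence.to (∈⇔ c≐Q j) j∈c))

    describes-≡ : ∀ {c d Q Q′} → Describes Q c → Describes Q′ d →
                  (∀ t → t ≤ N → Q t → Q′ t) → (∀ t → t ≤ N → Q′ t → Q t) → c ≡ d
    describes-≡ c≐Q d≐Q′ to from = ⊆-antisym (describes-⊆ c≐Q d≐Q′ to) (describes-⊆ d≐Q′ c≐Q from)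

    describes-∩ : ∀ {c d Q Q′} → Describes Q c → Describes Q′ d → Describes (λ t → Q t × Q′ t) (c ∩ d)
    describes-∩ {c} {d} c≐Q d≐Q′ = describes λ j → mk⇔
      (λ j∈c∩d → let j∈c , j∈d = x∈p∩q⁻ c d j∈c∩d in Equivalence.to (∈⇔ c≐Q j) j∈c , Equivalence.to (∈⇔ d≐Q′ j) j∈d)
      (λ (q , q′) → x∈p∩q⁺ (Equivalence.from (∈⇔ c≐Q j) q , Equivalence.from (∈⇔ d≐Q′ j) q′))

    apSubset-describes : ∀ a r k → Describes (InAP a r k) (apSubset (suc N) (suc a) r k)
    apSubset-describes a r k = describes (∈-apSubset⇔ a r k)

  ∈-triples : ∀ {n a r k} → a < n → r < n → k < suc n → (suc a , suc r , k) ∈ triples n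
  ∈-triples a<n r<n k≤n =
    ∈-concatMap⁺ _ (Any.map (λ { refl → ∈-concatMap⁺ _ (Any.map (λ { refl → ∈-map⁺ _ (∈-upTo⁺ k≤n) }) (∈-upTo⁺ r<n)) })
                          (∈-upTo⁺ a<n))

  apSubset∈Ln : ∀ {n a r k} → a < n → r < n → k < suc n → T (validAP n (suc a) (suc r) k) →
                apSubset n (suc a) (suc r) k ∈ Ln n
  apSubset∈Ln a<n r<n k≤n valid = ∈-deduplicate⁺ _≟S_ (∈-map⁺ _ (∈-filter⁺ _ (∈-triples a<n r<n k≤n) valid))

  ∈Ln⇒apSubset : ∀ {n c} → c ∈ Ln n → ∃[ a ] ∃[ r ] ∃[ k ] (T (validAP n a r k) × c ≡ apSubset n a r k)
  ∈Ln⇒apSubset {n} c∈ with ∈-map⁻ _ (∈-deduplicate⁻ _≟S_ _ c∈)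
  ... | (a , r , k) , t∈ , c≡ = a , r , k , proj₂ (∈-filter⁻ _ {xs = triples n} t∈) , c≡

  Ln-unique : ∀ n → Unique (Ln n)
  Ln-unique n = Unique.deduplicate-! _≟S_ _

  ∅∈Ln : ∀ {N} → apSubset (suc N) 1 1 0 ∈ Ln (suc N)
  ∅∈Ln = apSubset∈Ln (s≤s z≤n) (s≤s z≤n) (s≤s z≤n) tt

  progression∈Ln : ∀ {N} a r k → a + k * suc r ≤ N → apSubset (suc N) (suc a) (suc r) (suc k) ∈ Ln (suc N)
  -- A one-term progression does not depend on its step, which the enumeration bounds by n.
  progression∈Ln a r zero last≤N =
    apSubset∈Ln {r = 0} (s≤s (≤-trans (m≤m+n a 0) last≤N)) (s≤s z≤n) (s≤s (s≤s z≤n)) (≤⇒≤ᵇ (s≤s last≤N))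
  progression∈Ln a r (suc k) last≤N =
    apSubset∈Ln (s≤s (≤-trans (m≤m+n a _) last≤N)) (s≤s (≤-trans r≤ last≤N)) (s≤s (s≤s (≤-trans k<  last≤N)))
                (≤⇒≤ᵇ (s≤s last≤N))
    where
      r≤ : r ≤ a + suc k * suc r
      r≤ = ≤-trans (n≤1+n r) (≤-trans (m≤m+n (suc r) (k * suc r)) (m≤n+m _ a))
      k< : suc k ≤ a + suc k * suc r
      k< = ≤-trans (m≤m*n (suc k) (suc r)) (m≤n+m _ a)

  ⊤∈Ln : ∀ n → 1 ≤ n → ⊤ ∈ Ln n
  ⊤∈Ln (suc N) _ = subst (_∈ Ln (suc N)) ap≡⊤ (progression∈Ln 0 0 N (≤-reflexive (*-identityʳ N)))
    where
      ap≡⊤ : apSubset (suc N) 1 1 (suc N) ≡ ⊤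
      ap≡⊤ = describes-⊤ (apSubset-describes 0 1 (suc N)) (λ t t≤N → t , s≤s t≤N , sym (*-identityʳ t))

  withoutLast : ∀ N → Subset (suc N)
  withoutLast N = apSubset (suc N) 1 1 N

  withoutFirst : ∀ N → Subset (suc N)
  withoutFirst N = apSubset (suc N) 2 1 N

  withoutLast-describes : ∀ N → Describes (_< N) (withoutLast N)
  withoutLast-describes N = describes-cong (apSubset-describes 0 1 N)
    (λ t _ (i , i<N , t≡i*1) → subst (_< N) (sym (trans t≡i*1 (*-identityʳ i))) i<N)
    (λ t _ t<N → t , t<N , sym (*-identityʳ t))

  withoutFirst-describes : ∀ N → Describes (0 <_) (withoutFirst N)
  withoutFirst-describes N = describes-cong (apSubset-describes 1 1 N)
    (λ { t _ (i , _ , refl) → s≤s z≤n })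
    (λ { (suc t) t≤N _ → t , t≤N , cong suc (sym (*-identityʳ t)) })

  withoutLast∈Ln : ∀ N → withoutLast N ∈ Ln (suc N)
  withoutLast∈Ln zero = ∅∈Ln
  withoutLast∈Ln (suc M) = progression∈Ln 0 0 M (≤-trans (≤-reflexive (*-identityʳ M)) (n≤1+n M))

  withoutFirst∈Ln : ∀ N → withoutFirst N ∈ Ln (suc N)
  withoutFirst∈Ln zero = ∅∈Ln
  withoutFirst∈Ln (suc M) = progression∈Ln 1 0 M (s≤s (≤-reflexive (*-identityʳ M)))

  MultipleBetween : ℕ → ℕ → ℕ → ℕ → Set
  MultipleBetween m u w t = ∃[ s ] (t ≡ s * m × u ≤ s × s ≤ w)

  multiplesBetween∈Ln : ∀ N m u w → 1 ≤ m → w * m ≤ N →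
                        ∃[ z ] (z ∈ Ln (suc N) × Describes (MultipleBetween m u w) z)
  multiplesBetween∈Ln N m@(suc m0) u w _ wm≤N with u ≤? w
  ... | no u≰w = apSubset (suc N) 1 1 0 , ∅∈Ln ,
                 describes (λ j → mk⇔ (⊥-elim ∘′ ∉-apSubset-0 1 1 j) (λ (_ , _ , u≤s , s≤w) → ⊥-elim (u≰w (≤-trans u≤s s≤w))))
  ... | yes u≤w with m≤n⇒∃[o]m+o≡n u≤w
  ...   | d , u+d≡w = apSubset (suc N) (suc (u * m)) m (suc d) , progression∈Ln (u * m) m0 d last≤N ,
                         describes-cong (apSubset-describes (u * m) m (suc d)) to from
    where
      last≤N : u * m + d * m ≤ N
      last≤N = ≤-trans (≤-reflexive (trans (sym (*-distribʳ-+ m u d)) (cong (_* m) u+d≡w))) wm≤N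
      to : ∀ t → t ≤ N → InAP (u * m) m (suc d) t → MultipleBetween m u w t
      to t _ (i , i≤d , t≡) = u + i , trans t≡ (sym (*-distribʳ-+ m u i)) , m≤m+n u i ,
                              ≤-trans (+-monoʳ-≤ u (≤-pred i≤d)) (≤-reflexive u+d≡w)
      from : ∀ t → t ≤ N → MultipleBetween m u w t → InAP (u * m) m (suc d) t
      from t _ (s , t≡ , u≤s , s≤w) = s ∸ u ,
        s≤s (+-cancelˡ-≤ u _ _ (≤-trans (≤-reflexive (m+[n∸m]≡n u≤s)) (≤-trans s≤w (≤-reflexive (sym u+d≡w))))) ,
        trans t≡ (trans (cong (_* m) (sym (m+[n∸m]≡n u≤s))) (*-distribʳ-+ m u (s ∸ u)))

  multiples∈Ln : ∀ N d → 1 ≤ d → d ∣ N → ∃[ z ] (z ∈ Ln (suc N) × Describes (d ∣_) z)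
  multiples∈Ln N (suc d0) d≥1 (divides q N≡q*d) with multiplesBetween∈Ln N (suc d0) 0 q d≥1 (≤-reflexive (sym N≡q*d))
  ... | z , z∈Ln , z≐ = z , z∈Ln , describes-cong z≐
    (λ { t _ (s , t≡s*d , _ , _) → divides s t≡s*d })
    (λ { t t≤N (divides s t≡s*d) → s , t≡s*d , z≤n ,
           *-cancelʳ-≤ s q (suc d0) (≤-trans (≤-reflexive (sym t≡s*d)) (≤-trans t≤N (≤-reflexive N≡q*d))) })

  coatom-maximal : ∀ {n c z} → IsCoatom n c → z ∈ Ln n → c ⊆ z → z ≢ ⊤ → z ≡ c
  coatom-maximal (_ , _ , covers) z∈Ln c⊆z z≢⊤ with covers _ z∈Ln c⊆z
  ... | inj₁ z≡c = z≡c
  ... | inj₂ z≡⊤ = contradiction z≡⊤ z≢⊤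

  coatom-below : ∀ {N c d Q} → IsCoatom (suc N) c → d ∈ Ln (suc N) → Describes Q d →
                 ∀ t → t ≤ N → ¬ Q t → c ⊆ d → Describes Q c
  coatom-below {Q = Q} c-coatom d∈Ln d≐Q t t≤N ¬Qt c⊆d =
    subst (Describes Q) (coatom-maximal c-coatom d∈Ln c⊆d (λ { refl → describes-∉ d≐Q t t≤N ¬Qt ∈⊤ })) d≐Q

  point-≡ : ∀ {N t} (t≤N : t ≤ N) (j : Fin (suc N)) → toℕ j ≡ t → point t t≤N ≡ j
  point-≡ t≤N j j≡t = toℕ-injective (trans (toℕ-fromℕ< (s≤s t≤N)) (sym j≡t))

  IsPrimeMultiples : ∀ N → Subset (suc N) → Set
  IsPrimeMultiples N c = ∃[ p ] (Prime p × 1 ≤ N × p ∣ N × Describes (p ∣_) c)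

  CoatomShape : ∀ N → Subset (suc N) → Set
  CoatomShape N c = Describes (_< N) c ⊎ Describes (0 <_) c ⊎ IsPrimeMultiples N c

  module _ {N : ℕ} {c : Subset (suc N)} (c-coatom : IsCoatom (suc N) c) where

    -- A proper divisor d of R would give the progression of multiples of d strictly between c and [n].
    multiples-coatom-irreducible : ∀ {R} → 2 ≤ R → R ∣ N → 1 ≤ N → Describes (R ∣_) c → Irreducible R
    multiples-coatom-irreducible {R} (s≤s (s≤s _)) R∣N N≥1@(s≤s _) c≐R∣ {d} d∣R with d ≟ 1 | d ≟ R
    ... | yes d≡1 | _ = inj₁ d≡1
    ... | no _ | yes d≡R = inj₂ d≡R
    ... | no d≢1 | no d≢R = ⊥-elim (describes-∉ c≐R∣ d d≤N R∤d (describes-∈ c≐d∣ d d≤N ∣-refl))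
      where
        d<R : d < R
        d<R = ≤∧≢⇒< (∣⇒≤ d∣R) d≢R
        d≤N : d ≤ N
        d≤N = ≤-trans (<⇒≤ d<R) (∣⇒≤ R∣N)
        d≥1 : 1 ≤ d
        d≥1 = n≢0⇒n>0 (λ { refl → contradiction (0∣⇒≡0 d∣R) λ () })
        R∤d : ¬ R ∣ d
        R∤d R∣d = <⇒≱ d<R (∣⇒≤ ⦃ >-nonZero d≥1 ⦄ R∣d)
        c≐d∣ : Describes (d ∣_) c
        c≐d∣ with multiples∈Ln N d d≥1 (∣-trans d∣R R∣N)
        ... | D , D∈Ln , D≐ = coatom-below c-coatom D∈Ln D≐ 1 N≥1 (d≢1 ∘′ ∣1⇒≡1)
                                (describes-⊆ c≐R∣ D≐ (λ _ _ → ∣-trans d∣R))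

    private
      c≢⊤ : c ≢ ⊤
      c≢⊤ = proj₁ (proj₂ c-coatom)

    spanning-progression : ∀ {a R k} → Describes (InAP a R (suc k)) c → point 0 z≤n ∈ₛ c → point N ≤-refl ∈ₛ c →
                           a ≡ 0 × ∃[ iN ] (iN ≤ k × N ≡ iN * R)
    spanning-progression {a} {R} c≐ 0∈c N∈c with describes-∈⁻ c≐ 0 z≤n 0∈c | describes-∈⁻ c≐ N ≤-refl N∈c
    ... | _ , _ , 0≡a+iR | iN , iN<1+k , N≡a+iNR = a≡0 , iN , ≤-pred iN<1+k , trans N≡a+iNR (cong (_+ iN * R) a≡0)
      where
        a≡0 : a ≡ 0
        a≡0 = m+n≡0⇒m≡0 a (sym 0≡a+iR)

    -- With step 1, or with n = 1, a progression from 1 to n is all of [n].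
    spanning-progression-coatom : ∀ a R k → Describes (InAP a R (suc k)) c → 1 ≤ R →
                                  point 0 z≤n ∈ₛ c → point N ≤-refl ∈ₛ c → IsPrimeMultiples N c
    spanning-progression-coatom a 1 k c≐ _ 0∈c N∈c with spanning-progression c≐ 0∈c N∈c
    ... | a≡0 , iN , iN≤k , N≡iN*1 = ⊥-elim (c≢⊤ (describes-⊤ c≐ λ t t≤N →
          t , s≤s (≤-trans t≤N (≤-trans (≤-reflexive (trans N≡iN*1 (*-identityʳ iN))) iN≤k)) ,
          sym (trans (cong (_+ t * 1) a≡0) (*-identityʳ t))))
    spanning-progression-coatom a R@(suc (suc _)) k c≐ _ 0∈c N∈c with spanning-progression c≐ 0∈c N∈c
    ... | a≡0 , zero , _ , N≡0 = ⊥-elim (c≢⊤ (describes-⊤ c≐ λ t t≤N →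
          subst (InAP a R (suc k)) (sym (n≤0⇒n≡0 (≤-trans t≤N (≤-reflexive N≡0)))) (describes-∈⁻ c≐ 0 z≤n 0∈c)))
    ... | a≡0 , iN@(suc _) , iN≤k , N≡iNR = R , irreducible⇒prime (multiples-coatom-irreducible (s≤s (s≤s z≤n)) R∣N N≥1 c≐R∣) , N≥1 , R∣N , c≐R∣
      where
        R∣N : R ∣ N
        R∣N = divides iN N≡iNR
        N≥1 : 1 ≤ N
        N≥1 = ≤-trans (s≤s z≤n) (≤-trans (m≤m+n R _) (≤-reflexive (sym N≡iNR)))
        c≐R∣ : Describes (R ∣_) c
        c≐R∣ = describes-cong c≐
          (λ { t _ (i , _ , t≡) → divides i (trans t≡ (cong (_+ i * R) a≡0)) })
          (λ { t t≤N (divides s t≡sR) → s ,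
                 s≤s (≤-trans (*-cancelʳ-≤ s iN R (≤-trans (≤-reflexive (sym t≡sR)) (≤-trans t≤N (≤-reflexive N≡iNR)))) iN≤k) ,
                 trans t≡sR (cong (_+ s * R) (sym a≡0)) })

    coatom-shape : CoatomShape N c
    coatom-shape with point N ≤-refl ∈? c | point 0 z≤n ∈? c
    ... | no N∉c | _ = inj₁ (coatom-below c-coatom (withoutLast∈Ln N) (withoutLast-describes N) N ≤-refl (<-irrefl refl)
          (λ {j} j∈c → Equivalence.from (∈⇔ (withoutLast-describes N) j)
             (≤∧≢⇒< (toℕ≤N j) (λ j≡N → N∉c (subst (_∈ₛ c) (sym (point-≡ ≤-refl j j≡N)) j∈c)))))
    ... | yes _ | no 0∉c = inj₂ (inj₁ (coatom-below c-coatom (withoutFirst∈Ln N) (withoutFirst-describes N) 0 z≤n (λ ())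
          (λ {j} j∈c → Equivalence.from (∈⇔ (withoutFirst-describes N) j)
             (n≢0⇒n>0 (λ j≡0 → 0∉c (subst (_∈ₛ c) (sym (point-≡ z≤n j j≡0)) j∈c))))))
    ... | yes N∈c | yes 0∈c with ∈Ln⇒apSubset (proj₁ c-coatom)
    ...   | a , r , zero , _ , c≡ = ⊥-elim (∉-apSubset-0 a r _ (subst (point 0 z≤n ∈ₛ_) c≡ 0∈c))
    ...   | zero , r , suc k , () , _
    ...   | suc a , zero , suc k , () , _
    ...   | suc a , suc r , suc k , _ , c≡ = inj₂ (inj₂ (spanning-progression-coatom a (suc r) k
              (subst (Describes _) (sym c≡) (apSubset-describes a (suc r) (suc k))) (s≤s z≤n) 0∈c N∈c))

  described-by-multiples∈Ln : ∀ {N c Q} m u w → 1 ≤ m → w * m ≤ N → Describes Q c →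
    (∀ t → t ≤ N → Q t → MultipleBetween m u w t) → (∀ t → t ≤ N → MultipleBetween m u w t → Q t) → c ∈ Ln (suc N)
  described-by-multiples∈Ln {N} m u w m≥1 wm≤N c≐Q to from with multiplesBetween∈Ln N m u w m≥1 wm≤N
  ... | z , z∈Ln , z≐ = subst (_∈ Ln (suc N)) (sym (describes-≡ c≐Q z≐ to from)) z∈Ln

  CoatomMeet : ℕ → ℕ → Bool → Bool → ℕ → Set
  CoatomMeet N m dropFirst dropLast t = m ∣ t × (T dropFirst → 0 < t) × (T dropLast → t < N)

  lower : Bool → ℕ
  lower true = 1
  lower false = 0

  lower≤⇒positive : ∀ α s m → lower α ≤ s → T α → 0 < s * suc m
  lower≤⇒positive true (suc s) m _ _ = s≤s z≤n

  positive⇒lower≤ : ∀ α s m → (T α → 0 < s * m) → lower α ≤ s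
  positive⇒lower≤ false s m _ = z≤n
  positive⇒lower≤ true zero m 0<0 with () ← 0<0 _
  positive⇒lower≤ true (suc s) m _ = s≤s z≤n

  coatomMeet∈Ln : ∀ N m α β {c} → 1 ≤ m → m ∣ N → Describes (CoatomMeet N m α β) c → c ∈ Ln (suc N)
  coatomMeet∈Ln N m@(suc m0) α false m≥1 (divides q N≡qm) c≐ =
    described-by-multiples∈Ln m (lower α) q m≥1 (≤-reflexive (sym N≡qm)) c≐
      (λ { t t≤N (divides s t≡sm , pos , _) → s , t≡sm , positive⇒lower≤ α s m (subst (0 <_) t≡sm ∘′ pos) ,
             *-cancelʳ-≤ s q m (≤-trans (≤-reflexive (sym t≡sm)) (≤-trans t≤N (≤-reflexive N≡qm))) })
      (λ { t _ (s , t≡sm , lower≤s , _) → divides s t≡sm , subst (0 <_) (sym t≡sm) ∘′ lower≤⇒positive α s m0 lower≤s , λ () })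
  coatomMeet∈Ln N m α true m≥1 (divides zero N≡0) c≐ =
    described-by-multiples∈Ln m 1 0 m≥1 z≤n c≐
      (λ { t t≤N (_ , _ , t<N) → ⊥-elim (<⇒≱ (t<N _) (≤-trans (≤-reflexive N≡0) z≤n)) })
      (λ { t _ (_ , _ , 1≤s , s≤0) → ⊥-elim (<⇒≱ 1≤s s≤0) })
  coatomMeet∈Ln N m@(suc m0) α true m≥1 (divides (suc q) N≡qm) c≐ =
    described-by-multiples∈Ln m (lower α) q m≥1 (≤-trans (m≤n+m (q * m) m) (≤-reflexive (sym N≡qm))) c≐
      (λ { t t≤N (divides s t≡sm , pos , t<N) → s , t≡sm , positive⇒lower≤ α s m (subst (0 <_) t≡sm ∘′ pos) ,
             ≤-pred (*-cancelʳ-< m s (suc q) (≤-trans (s≤s (≤-reflexive (sym t≡sm))) (≤-trans (t<N _) (≤-reflexive N≡qm)))) })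
      (λ { t _ (s , t≡sm , lower≤s , s≤q) → divides s t≡sm , subst (0 <_) (sym t≡sm) ∘′ lower≤⇒positive α s m0 lower≤s ,
             λ _ → ≤-trans (s≤s (≤-trans (≤-reflexive t≡sm) (*-monoˡ-≤ m s≤q))) (≤-trans (s≤s (m≤n+m (q * m) m0)) (≤-reflexive (sym N≡qm))) })

  coatom-meet-shape : ∀ N T → All (IsCoatom (suc N)) T →
    ∃[ m ] ∃[ α ] ∃[ β ] (1 ≤ m × m ∣ N × Describes (CoatomMeet N m α β) (⋂ T))
  coatom-meet-shape N [] [] = 1 , false , false , s≤s z≤n , divides N (sym (*-identityʳ N)) ,
    describes λ j → mk⇔ (λ _ → divides (toℕ j) (sym (*-identityʳ _)) , (λ ()) , (λ ())) (λ _ → ∈⊤)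
  coatom-meet-shape N (c ∷ T) (c-coatom ∷ T-coatoms) with coatom-meet-shape N T T-coatoms | coatom-shape c-coatom
  ... | m , α , β , m≥1 , m∣N , T≐ | inj₁ c≐ = m , α , true , m≥1 , m∣N ,
        describes-cong (describes-∩ c≐ T≐) (λ { t _ (t<N , m∣t , pos , _) → m∣t , pos , (λ _ → t<N) })
                                           (λ { t _ (m∣t , pos , t<N) → t<N _ , m∣t , pos , (λ _ → t<N _) })
  ... | m , α , β , m≥1 , m∣N , T≐ | inj₂ (inj₁ c≐) = m , true , β , m≥1 , m∣N ,
        describes-cong (describes-∩ c≐ T≐) (λ { t _ (0<t , m∣t , _ , t<N) → m∣t , (λ _ → 0<t) , t<N })
                                           (λ { t _ (m∣t , pos , t<N) → pos _ , m∣t , (λ _ → pos _) , t<N })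
  ... | m , α , β , m≥1 , m∣N , T≐ | inj₂ (inj₂ (p , _ , N≥1 , p∣N , c≐)) = lcm m p , α , β , lcm≥1 , lcm∣N ,
        describes-cong (describes-∩ c≐ T≐) (λ { t _ (p∣t , m∣t , pos , t<N) → lcm-least m∣t p∣t , pos , t<N })
          (λ { t _ (lcm∣t , pos , t<N) → ∣-trans (n∣lcm[m,n] m p) lcm∣t , ∣-trans (m∣lcm[m,n] m p) lcm∣t , pos , t<N })
    where
      lcm∣N : lcm m p ∣ N
      lcm∣N = lcm-least m∣N p∣N
      lcm≥1 : 1 ≤ lcm m p
      lcm≥1 = n≢0⇒n>0 (λ lcm≡0 → <⇒≱ N≥1 (≤-reflexive (0∣⇒≡0 (subst (_∣ N) lcm≡0 lcm∣N))))

  ⋂-coatoms∈Ln : ∀ n → 1 ≤ n → ∀ T → All (IsCoatom n) T → ⋂ T ∈ Ln n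
  ⋂-coatoms∈Ln (suc N) _ T T-coatoms with coatom-meet-shape N T T-coatoms
  ... | m , α , β , m≥1 , m∣N , T≐ = coatomMeet∈Ln N m α β m≥1 m∣N T≐

  p-free-part : ∀ p → Prime p → ∀ N → 1 ≤ N → p ∣ N →
    ∃[ M ] (1 ≤ M × M < N × ¬ p ∣ M × (∀ q → Prime q → q ≢ p → q ∣ N → q ∣ M))
  p-free-part p p-prime N N≥1 p∣N with strip N (<-wellFounded N) N≥1
    where
      strip : ∀ N → Acc _<_ N → 1 ≤ N → ∃[ M ] (1 ≤ M × M ∣ N × ¬ p ∣ M × (∀ q → Prime q → q ≢ p → q ∣ N → q ∣ M))
      strip N (acc smaller) N≥1 with p ∣? N
      ... | no p∤N = N , N≥1 , ∣-refl , p∤N , (λ _ _ _ q∣N → q∣N)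
      ... | yes (divides e N≡ep) with strip e (smaller e<N) e≥1
        where
          e≥1 : 1 ≤ e
          e≥1 = n≢0⇒n>0 (λ { refl → <⇒≱ N≥1 (≤-reflexive N≡ep) })
          e<N : e < N
          e<N = subst (e <_) (sym N≡ep) (m<m*n e p ⦃ >-nonZero e≥1 ⦄ (nonTrivial⇒n>1 p ⦃ prime⇒nonTrivial p-prime ⦄))
      ...   | M , M≥1 , M∣e , p∤M , keeps = M , M≥1 , ∣-trans M∣e (divides p (trans N≡ep (*-comm e p))) , p∤M , keeps′
        where
          keeps′ : ∀ q → Prime q → q ≢ p → q ∣ N → q ∣ M
          keeps′ q q-prime q≢p q∣N with euclidsLemma e p q-prime (subst (q ∣_) N≡ep q∣N)
          ... | inj₁ q∣e = keeps q q-prime q≢p q∣e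
          ... | inj₂ q∣p with prime⇒irreducible p-prime q∣p
          ...   | inj₁ refl = ⊥-elim (¬prime[1] q-prime)
          ...   | inj₂ q≡p = contradiction q≡p q≢p
  ... | M , M≥1 , M∣N , p∤M , keeps = M , M≥1 , ≤∧≢⇒< (∣⇒≤ ⦃ >-nonZero N≥1 ⦄ M∣N) (λ { refl → p∤M p∣N }) , p∤M , keeps

  describes-unique : ∀ {N Q} {c d : Subset (suc N)} → Describes Q c → Describes Q d → c ≡ d
  describes-unique c≐ d≐ = describes-≡ c≐ d≐ (λ _ _ q → q) (λ _ _ q → q)

  -- For n = 1 both segments are empty, hence equal.
  distinct-segments⇒1≤N : ∀ {N} {c d : Subset (suc N)} → Describes (_< N) c → Describes (0 <_) d → c ≢ d → 1 ≤ N
  distinct-segments⇒1≤N {zero} c≐ d≐ c≢d = ⊥-elim (c≢d (describes-≡ c≐ d≐ (λ _ _ ()) (λ { zero _ () })))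
  distinct-segments⇒1≤N {suc N} _ _ _ = s≤s z≤n

  coatom-private-point : ∀ N {c} → IsCoatom (suc N) c →
                         ∃[ y ] (y ∉ₛ c × (∀ d → IsCoatom (suc N) d → d ≢ c → y ∈ₛ d))
  coatom-private-point N c-coatom with coatom-shape c-coatom
  ... | inj₁ c≐ = point N ≤-refl , describes-∉ c≐ N ≤-refl (<-irrefl refl) , in-others
    where
      in-others : ∀ d → IsCoatom (suc N) d → d ≢ _ → point N ≤-refl ∈ₛ d
      in-others d d-coatom d≢c with coatom-shape d-coatom
      ... | inj₁ d≐ = contradiction (describes-unique d≐ c≐) d≢c
      ... | inj₂ (inj₁ d≐) = describes-∈ d≐ N ≤-refl (distinct-segments⇒1≤N c≐ d≐ (d≢c ∘′ sym))
      ... | inj₂ (inj₂ (_ , _ , _ , p∣N , d≐)) = describes-∈ d≐ N ≤-refl p∣N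
  ... | inj₂ (inj₁ c≐) = point 0 z≤n , describes-∉ c≐ 0 z≤n (λ ()) , in-others
    where
      in-others : ∀ d → IsCoatom (suc N) d → d ≢ _ → point 0 z≤n ∈ₛ d
      in-others d d-coatom d≢c with coatom-shape d-coatom
      ... | inj₁ d≐ = describes-∈ d≐ 0 z≤n (distinct-segments⇒1≤N d≐ c≐ d≢c)
      ... | inj₂ (inj₁ d≐) = contradiction (describes-unique d≐ c≐) d≢c
      ... | inj₂ (inj₂ (_ , _ , _ , _ , d≐)) = describes-∈ d≐ 0 z≤n (divides 0 refl)
  ... | inj₂ (inj₂ (p , p-prime , N≥1 , p∣N , c≐)) with p-free-part p p-prime N N≥1 p∣N
  ...   | M , M≥1 , M<N , p∤M , keeps = point M (<⇒≤ M<N) , describes-∉ c≐ M (<⇒≤ M<N) p∤M , in-others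
    where
      in-others : ∀ d → IsCoatom (suc N) d → d ≢ _ → point M (<⇒≤ M<N) ∈ₛ d
      in-others d d-coatom d≢c with coatom-shape d-coatom
      ... | inj₁ d≐ = describes-∈ d≐ M (<⇒≤ M<N) M<N
      ... | inj₂ (inj₁ d≐) = describes-∈ d≐ M (<⇒≤ M<N) M≥1
      ... | inj₂ (inj₂ (q , q-prime , _ , q∣N , d≐)) with q ≟ p
      ...   | yes refl = contradiction (describes-unique d≐ c≐) d≢c
      ...   | no q≢p = describes-∈ d≐ M (<⇒≤ M<N) (keeps q q-prime q≢p q∣N)

  ⋂-omitting-coatom-⊈ : ∀ N {c} T → IsCoatom (suc N) c → All (IsCoatom (suc N)) T → c ∉ T → ¬ ⋂ T ⊆ c
  ⋂-omitting-coatom-⊈ N T c-coatom T-coatoms c∉T ⋂T⊆c with coatom-private-point N c-coatom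
  ... | y , y∉c , y∈others = y∉c (⋂T⊆c (Crosscut.∈⋂⁺ T (All.tabulate λ {d} d∈T →
          y∈others d (All.lookup T-coatoms d∈T) (λ { refl → c∉T d∈T }))))

open Crosscut
open ArithmeticProgressions

theorem7 : (n : ℕ) → 1 ≤ n → (x : Subset n) → x ∈ Ln n → x ≢ ⊤ →
    ((S : List (Subset n)) → Unique S → (∀ c → c ∈ S ⇔ (IsCoatom n c × x ⊆ c)) →
        x ≡ ⋂ S → μ n x ⊤ ≡ -1ℤ ^ length S)
    × (((S : List (Subset n)) → All (IsCoatom n) S → x ≢ ⋂ S) →
        μ n x ⊤ ≡ 0ℤ)
theorem7 n@(suc N) n≥1 x _ _ = meet-of-coatoms , not-a-meet
  where
    μ-crosscut : ∀ C → (∀ c → c ∈ C ⇔ (IsCoatom n c × x ⊆ c)) → μ n x ⊤ ≡ ∑ (sublists C) (λ T → [ x ≟S ⋂ T ]· sgn T)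
    μ-crosscut = crosscut (Ln n) (Ln-unique n) (⊤∈Ln n n≥1) (⋂-coatoms∈Ln n n≥1) x

    sublist-coatoms : ∀ {C} → (∀ c → c ∈ C ⇔ (IsCoatom n c × x ⊆ c)) → ∀ {T} → T ∈ sublists C → All (IsCoatom n) T
    sublist-coatoms {C} C-spec T∈ = All.tabulate λ c∈T → proj₁ (Equivalence.to (C-spec _) (∈-sublists⇒⊆ C T∈ c∈T))

    meet-of-coatoms : (S : List (Subset n)) → Unique S → (∀ c → c ∈ S ⇔ (IsCoatom n c × x ⊆ c)) →
                      x ≡ ⋂ S → μ n x ⊤ ≡ -1ℤ ^ length S
    meet-of-coatoms S S-unique S-spec x≡⋂S = begin
      μ n x ⊤                                      ≡⟨ μ-crosscut S S-spec ⟩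
      ∑ (sublists S) (λ T → [ x ≟S ⋂ T ]· sgn T)   ≡⟨ ∑-sublists-only-self S _ only-S ⟩
      [ x ≟S ⋂ S ]· sgn S                          ≡⟨ []·-yes (x ≟S ⋂ S) x≡⋂S ⟩
      -1ℤ ^ length S ∎
      where
        open ≡-Reasoning
        only-S : ∀ T → T ∈ sublists S → T ≢ S → [ x ≟S ⋂ T ]· sgn T ≡ 0ℤ
        only-S T T∈ T≢S = []·-no (x ≟S ⋂ T) λ x≡⋂T →
          let c , c∈S , c∉T = ∈-sublists-≢⇒missing S S-unique T∈ T≢S
              c-coatom , x⊆c = Equivalence.to (S-spec c) c∈S
          in ⋂-omitting-coatom-⊈ N T c-coatom (sublist-coatoms S-spec T∈) c∉T (subst (_⊆ c) x≡⋂T x⊆c)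

    not-a-meet : ((S : List (Subset n)) → All (IsCoatom n) S → x ≢ ⋂ S) → μ n x ⊤ ≡ 0ℤ
    not-a-meet x≢⋂ = trans (μ-crosscut C C-spec)
      (∑-zero (sublists C) λ T T∈ → []·-no (x ≟S ⋂ T) (x≢⋂ T (sublist-coatoms C-spec T∈)))
      where
        C : List (Subset n)
        C = coatomsAbove (Ln n) x
        C-spec : ∀ c → c ∈ C ⇔ (IsCoatom n c × x ⊆ c)
        C-spec = ∈-coatomsAbove⇔ (Ln n) x
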